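{- Let $q=2^m$ where $m\ge 3$, and let $B=\{u\in\mathrm{GF}(q):\mathrm{Tr}(u^3)=1\}$. Then for every $t\in\mathrm{GF}(q)^*$ there exists $x_1\in B$ with $\mathrm{Tr}(tx_1)=1$.
   Context: $\mathrm{Tr}$ denotes the absolute trace from $\mathrm{GF}(2^m)$ to $\mathrm{GF}(2)$. -}

module Defs where

open import Level using (0ℓ)
open import Data.Nat using (ℕ; zero; suc; _^_)
open import Data.Fin using (Fin)
open import Data.Product using (∃)
open import Relation.Binary.PropositionalEquality using (_≡_; _≢_)
open import Algebra.Core using (Op₁; Op₂)
open import Algebra.Structures using (IsCommutativeRing)
open import Function.Bundles using (_↔_)

record GF2^ (m : ℕ) : Set₁ where
  infixl 6 _+_
  infixl 7 _*_
  field
    F          : Set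
    _+_ _*_    : Op₂ F
    -_         : Op₁ F
    0# 1#      : F
    isCommRing : IsCommutativeRing _≡_ _+_ _*_ -_ 0# 1#
    0≢1        : 0# ≢ 1#
    inverse    : ∀ x → x ≢ 0# → ∃ λ y → x * y ≡ 1#
    card       : Fin (2 ^ m) ↔ F

  frob : ℕ → F → F
  frob zero    x = x
  frob (suc i) x = frob i x * frob i x

  trSum : ℕ → F → F
  trSum zero    x = 0#
  trSum (suc n) x = trSum n x + frob n x

  Tr : F → F
  Tr = trSum m

  cube : F → F
  cube u = u * u * u

-- Module TraceForms (m ≥ 1) studies Q(x) = Tr(x³), whose polar form is
-- Tr(x L(a)) with L(a) = a² + a^(2^(m-1)) and L(a)² = a⁴ + a.  Supposing Q vanishes on
-- the affine hyperplane Tr(t x) = 1, Q is linear on the hyperplane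
-- Tr(t x) = 0, which forces L(a) = t whenever Q(a) = 1; then t = 1 and every
-- such a is a root of x⁴ + x + 1, which is impossible.  So Q ≡ 0, hence
-- L ≡ 0 and x⁴ = x on all of F, contradicting the root bound when m ≥ 3.
module Submission where

open import Level using (0ℓ)
open import Data.Nat as ℕ using (ℕ; zero; suc; _≤_; _<_; z≤n; s≤s; _≤′_)
import Data.Nat.Properties as ℕₚ
open import Data.Fin using (Fin; inject≤)
import Data.Fin.Properties as Finₚ
import Data.Fin.Permutation as Perm
open import Data.Maybe using (nothing)
open import Data.Product using (∃; _×_; _,_; proj₁; proj₂)
open import Data.Sum using (_⊎_; inj₁; inj₂; [_,_]′)
open import Data.Empty using (⊥; ⊥-elim)
open import Function using (_∘_; id)
open import Function.Bundles using (Inverse)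
open import Function.Definitions using (Injective)
open import Relation.Nullary using (Dec; yes; no; ¬_)
open import Relation.Nullary.Decidable using (map′; _×-dec_)
open import Relation.Unary using (Decidable)
open import Relation.Binary.PropositionalEquality
  using (_≡_; _≢_; refl; sym; trans; cong; cong₂; subst; module ≡-Reasoning)
open import Algebra.Bundles using (CommutativeRing; CommutativeMonoid)
open import Algebra.Structures using (IsCommutativeRing)
import Algebra.Properties.CommutativeMonoid.Sum as MonoidSum
import Algebra.Properties.CommutativeSemiring.Exp as Exp
import Algebra.Properties.Semiring.Mult as Mult
import Algebra.Properties.Group as GroupProperties
import Algebra.Solver.Ring.NaturalCoefficients as NatSolver
open import Defs

2^n<2^1+n : ∀ n → 2 ℕ.^ n < 2 ℕ.^ suc n
2^n<2^1+n n = ℕₚ.^-monoʳ-< 2 (s≤s (s≤s z≤n)) (ℕₚ.n<1+n n)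

module FiniteField {m : ℕ} (K : GF2^ m) where
  open GF2^ K public
  open IsCommutativeRing isCommRing public
    using ( +-assoc; +-comm; +-identityˡ; +-identityʳ; -‿inverseˡ; -‿inverseʳ
          ; *-assoc; *-comm; *-identityˡ; *-identityʳ; zeroˡ; zeroʳ; distribˡ; distribʳ )

  ring : CommutativeRing 0ℓ 0ℓ
  ring = record { isCommutativeRing = isCommRing }

  open Exp (CommutativeRing.commutativeSemiring ring) public using (_^_; ^-homo-*)
  open NatSolver (CommutativeRing.commutativeSemiring ring) (λ _ _ → nothing)
    using (solve; _:=_; _:+_; _:*_)

  q : ℕ
  q = 2 ℕ.^ m

  elem : Fin q → F
  elem = Inverse.to card

  index : F → Fin q
  index = Inverse.from card

  elem-index : ∀ x → elem (index x) ≡ x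
  elem-index = Inverse.strictlyInverseˡ card

  index-elem : ∀ i → index (elem i) ≡ i
  index-elem = Inverse.strictlyInverseʳ card

  elem-injective : Injective _≡_ _≡_ elem
  elem-injective {i} {j} e = trans (sym (index-elem i)) (trans (cong index e) (index-elem j))

  infix 4 _≟_
  _≟_ : (x y : F) → Dec (x ≡ y)
  x ≟ y = map′ (λ e → trans (sym (elem-index x)) (trans (cong elem e) (elem-index y)))
               (cong index) (index x Finₚ.≟ index y)

  search : {P : F → Set} → Decidable P → Dec (∃ P)
  search {P} P? = map′ (λ (i , p) → elem i , p)
                       (λ (x , p) → index x , subst P (sym (elem-index x)) p)
                       (Finₚ.any? (P? ∘ elem))

  permutationOf : (σ σ⁻¹ : F → F) → (∀ x → σ (σ⁻¹ x) ≡ x) → (∀ x → σ⁻¹ (σ x) ≡ x) →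
                  Perm.Permutation′ q
  permutationOf σ σ⁻¹ σσ⁻¹ σ⁻¹σ =
    Perm.permutation (conj σ) (conj σ⁻¹) (undo σ σ⁻¹ σσ⁻¹) (undo σ⁻¹ σ σ⁻¹σ)
    where
    conj : (F → F) → Fin q → Fin q
    conj τ i = index (τ (elem i))
    undo : ∀ τ τ′ → (∀ x → τ (τ′ x) ≡ x) → ∀ i → conj τ (conj τ′ i) ≡ i
    undo τ τ′ ττ′ i = trans (cong (index ∘ τ) (elem-index (τ′ (elem i))))
                                 (trans (cong index (ττ′ (elem i))) (index-elem i))

  module _ {c ℓ} (M : CommutativeMonoid c ℓ) where
    open CommutativeMonoid M
      using (Carrier; _≈_; _∙_; ε; reflexive; ∙-cong; ∙-congˡ; identityˡ; identityʳ)
      renaming (trans to ≈-trans)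
    open MonoidSum M using (sum; ∑-permute; sum-cong-≗; sum-replicate-zero)

    sum-reindex : (σ σ⁻¹ : F → F) → (∀ x → σ (σ⁻¹ x) ≡ x) → (∀ x → σ⁻¹ (σ x) ≡ x) →
                  (h : F → Carrier) → sum (h ∘ elem) ≈ sum (h ∘ σ ∘ elem)
    sum-reindex σ σ⁻¹ σσ⁻¹ σ⁻¹σ h =
      ≈-trans (∑-permute (h ∘ elem) (permutationOf σ σ⁻¹ σσ⁻¹ σ⁻¹σ))
              (reflexive (sum-cong-≗ (λ i → cong h (elem-index (σ (elem i))))))

    sum-single : ∀ {n} (t : Fin n → Carrier) i → (∀ j → j ≢ i → t j ≡ ε) → sum t ≈ t i
    sum-single {suc n} t Fin.zero rest = ≈-trans (∙-congˡ tail≈ε) (identityʳ (t Fin.zero))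
      where
      tail≈ε : sum (t ∘ Fin.suc) ≈ ε
      tail≈ε = ≈-trans (reflexive (sum-cong-≗ λ j → rest (Fin.suc j) λ ())) (sum-replicate-zero n)
    sum-single {suc n} t (Fin.suc i) rest =
      ≈-trans (∙-cong (reflexive (rest Fin.zero λ ()))
                      (sum-single (t ∘ Fin.suc) i λ j j≢i → rest (Fin.suc j) (j≢i ∘ Finₚ.suc-injective)))
              (identityˡ (t (Fin.suc i)))

  1≢0 : 1# ≢ 0#
  1≢0 = 0≢1 ∘ sym

  unscaleʳ : ∀ {c c′} → c * c′ ≡ 1# → ∀ a → (a * c) * c′ ≡ a
  unscaleʳ {c} {c′} cc′ a = trans (*-assoc a c c′) (trans (cong (a *_) cc′) (*-identityʳ a))

  unscaleˡ : ∀ {c c′} → c * c′ ≡ 1# → ∀ a → c * (c′ * a) ≡ a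
  unscaleˡ {c} {c′} cc′ a = trans (sym (*-assoc c c′ a)) (trans (cong (_* a) cc′) (*-identityˡ a))

  *-cancelʳ : ∀ {a b c} → c ≢ 0# → a * c ≡ b * c → a ≡ b
  *-cancelʳ {a} {b} {c} c≢0 ac≡bc =
    let (c′ , cc′) = inverse c c≢0
    in trans (sym (unscaleʳ cc′ a)) (trans (cong (_* c′) ac≡bc) (unscaleʳ cc′ b))

  zero-product : ∀ {x y} → x * y ≡ 0# → x ≢ 0# → y ≡ 0#
  zero-product {x} {y} xy≡0 x≢0 = *-cancelʳ x≢0 (trans (*-comm y x) (trans xy≡0 (sym (zeroˡ x))))

  *-nonzero : ∀ {x y} → x ≢ 0# → y ≢ 0# → x * y ≢ 0#
  *-nonzero x≢0 y≢0 xy≡0 = y≢0 (zero-product xy≡0 x≢0)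

  ^-zero : ∀ {x} n → x ^ n ≡ 0# → x ≡ 0#
  ^-zero zero 1≡0 = ⊥-elim (1≢0 1≡0)
  ^-zero {x} (suc n) xⁿ⁺¹≡0 with x ≟ 0#
  ... | yes x≡0 = x≡0
  ... | no x≢0 = ^-zero n (zero-product xⁿ⁺¹≡0 x≢0)

  idempotent : ∀ {e} → e * e ≡ e → e ≡ 0# ⊎ e ≡ 1#
  idempotent {e} ee≡e with e ≟ 0#
  ... | yes e≡0 = inj₁ e≡0
  ... | no e≢0 = inj₂ (*-cancelʳ e≢0 (trans ee≡e (sym (*-identityˡ e))))

  module Additive where
    open MonoidSum (CommutativeRing.+-commutativeMonoid ring) public
      using (sum; ∑-distrib-+; sum-replicate)
    open Mult (CommutativeRing.semiring ring) public using (×1-homo-*) renaming (_×_ to _·_)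
    open GroupProperties (CommutativeRing.+-group ring) public using (∙-cancelˡ; ∙-cancelʳ)
  open Additive using (_·_)

  -- q · 1 = 0: the sums of x and of x + 1 over all x ∈ F coincide.
  q·1≡0 : q · 1# ≡ 0#
  q·1≡0 = sym (∙-cancelˡ S 0# (q · 1#) (begin
      S + 0#                          ≡⟨ +-identityʳ S ⟩
      S                               ≡⟨ sum-reindex (CommutativeRing.+-commutativeMonoid ring)
                                           (_+ 1#) (_+ - 1#) (shift 1# (- 1#) (-‿inverseˡ 1#))
                                           (shift (- 1#) 1# (-‿inverseʳ 1#)) id ⟩
      sum {q} (λ i → elem i + 1#)     ≡⟨ ∑-distrib-+ elem (λ _ → 1#) ⟩
      S + sum {q} (λ _ → 1#)          ≡⟨ cong (S +_) (sum-replicate q) ⟩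
      S + q · 1#                      ∎))
    where
    open Additive
    open ≡-Reasoning
    S : F
    S = sum {q} elem
    shift : ∀ a b → b + a ≡ 0# → ∀ x → (x + b) + a ≡ x
    shift a b b+a≡0 x = trans (+-assoc x b a) (trans (cong (x +_) b+a≡0) (+-identityʳ x))

  two-power : ∀ k → (2 ℕ.^ k) · 1# ≡ (1# + 1#) ^ k
  two-power zero = +-identityʳ 1#
  two-power (suc k) = trans (Additive.×1-homo-* 2 (2 ℕ.^ k))
                            (cong₂ _*_ (cong (1# +_) (+-identityʳ 1#)) (two-power k))

  1+1≡0 : 1# + 1# ≡ 0#
  1+1≡0 = ^-zero m (trans (sym (two-power m)) q·1≡0)

  x+x≡0 : ∀ x → x + x ≡ 0#
  x+x≡0 x = begin
    x + x              ≡⟨ cong₂ _+_ (sym (*-identityʳ x)) (sym (*-identityʳ x)) ⟩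
    x * 1# + x * 1#    ≡⟨ sym (distribˡ x 1# 1#) ⟩
    x * (1# + 1#)      ≡⟨ cong (x *_) 1+1≡0 ⟩
    x * 0#             ≡⟨ zeroʳ x ⟩
    0#                 ∎
    where open ≡-Reasoning

  drop-double : ∀ u v → u + (v + v) ≡ u
  drop-double u v = trans (cong (u +_) (x+x≡0 v)) (+-identityʳ u)

  +-solve : ∀ {a b c} → a + b ≡ c → b ≡ a + c
  +-solve {a} {b} {c} a+b≡c = begin
    b                  ≡⟨ sym (drop-double b a) ⟩
    b + (a + a)        ≡⟨ solve 2 (λ a b → b :+ (a :+ a) := a :+ (a :+ b)) refl a b ⟩
    a + (a + b)        ≡⟨ cong (a +_) a+b≡c ⟩
    a + c              ∎
    where open ≡-Reasoning

  sum≡0⇒≡ : ∀ {a b} → a + b ≡ 0# → a ≡ b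
  sum≡0⇒≡ {a} a+b≡0 = sym (trans (+-solve a+b≡0) (+-identityʳ a))

  square-+ : ∀ a b → (a + b) * (a + b) ≡ a * a + b * b
  square-+ a b = begin
    (a + b) * (a + b)                 ≡⟨ solve 2 (λ a b → (a :+ b) :* (a :+ b) :=
                                           a :* a :+ b :* b :+ (a :* b :+ a :* b)) refl a b ⟩
    a * a + b * b + (a * b + a * b)   ≡⟨ drop-double (a * a + b * b) (a * b) ⟩
    a * a + b * b                     ∎
    where open ≡-Reasoning

  module Multiplicative where
    open MonoidSum (CommutativeRing.*-commutativeMonoid ring) public
      using (sum-replicate; sum-cong-≗; ∑-distrib-+) renaming (sum to prod)

  prod-nonzero : ∀ {n} (t : Fin n → F) → (∀ i → t i ≢ 0#) → Multiplicative.prod t ≢ 0#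
  prod-nonzero {zero}  t t≢0 = 1≢0
  prod-nonzero {suc n} t t≢0 = *-nonzero (t≢0 Fin.zero) (prod-nonzero (t ∘ Fin.suc) (t≢0 ∘ Fin.suc))

  unit : F → F
  unit y with y ≟ 0#
  ... | yes _ = 1#
  ... | no _  = y

  unit≢0 : ∀ y → unit y ≢ 0#
  unit≢0 y with y ≟ 0#
  ... | yes _   = 1≢0
  ... | no y≢0  = y≢0

  module _ (x : F) (x≢0 : x ≢ 0#) where
    open Multiplicative

    x⁻¹ : F
    x⁻¹ = proj₁ (inverse x x≢0)

    x*x⁻¹ : x * x⁻¹ ≡ 1#
    x*x⁻¹ = proj₂ (inverse x x≢0)

    defect : F → F
    defect y with y ≟ 0#
    ... | yes _ = x
    ... | no _  = 1#

    scale-unit : ∀ y → x * unit y ≡ defect y * unit (x * y)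
    scale-unit y with y ≟ 0# | x * y ≟ 0#
    ... | yes _   | yes _     = trans (*-identityʳ x) (sym (*-identityʳ x))
    ... | yes y≡0 | no xy≢0   = ⊥-elim (xy≢0 (trans (cong (x *_) y≡0) (zeroʳ x)))
    ... | no y≢0  | yes xy≡0  = ⊥-elim (*-nonzero x≢0 y≢0 xy≡0)
    ... | no _    | no _      = sym (*-identityˡ (x * y))

    defect-product : prod {q} (defect ∘ elem) ≡ x
    defect-product =
      trans (sum-single (CommutativeRing.*-commutativeMonoid ring) (defect ∘ elem) (index 0#) away-from-0)
            (trans (cong defect (elem-index 0#)) at-0)
      where
      at-0 : defect 0# ≡ x
      at-0 with 0# ≟ 0#
      ... | yes _  = refl
      ... | no 0≢0 = ⊥-elim (0≢0 refl)
      away-from-0 : ∀ j → j ≢ index 0# → defect (elem j) ≡ 1#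
      away-from-0 j j≢0 with elem j ≟ 0#
      ... | yes j↦0 = ⊥-elim (j≢0 (trans (sym (index-elem j)) (cong index j↦0)))
      ... | no _    = refl

    fermat-nonzero : x ^ q ≡ x
    fermat-nonzero = *-cancelʳ (prod-nonzero (unit ∘ elem) (unit≢0 ∘ elem)) (begin
      x ^ q * P                                            ≡⟨ cong (_* P) (sym (sum-replicate q)) ⟩
      prod {q} (λ _ → x) * P                               ≡⟨ sym (∑-distrib-+ (λ _ → x) (unit ∘ elem)) ⟩
      prod {q} (λ i → x * unit (elem i))                   ≡⟨ sum-cong-≗ (scale-unit ∘ elem) ⟩
      prod {q} (λ i → defect (elem i) * unit (x * elem i))
                                                           ≡⟨ ∑-distrib-+ (defect ∘ elem) (λ i → unit (x * elem i)) ⟩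
      prod {q} (defect ∘ elem) * prod {q} (λ i → unit (x * elem i))
                                                           ≡⟨ cong₂ _*_ defect-product (sym reindexed) ⟩
      x * P                                                ∎)
      where
      open ≡-Reasoning
      P : F
      P = prod {q} (unit ∘ elem)
      reindexed : P ≡ prod {q} (λ i → unit (x * elem i))
      reindexed = sum-reindex (CommutativeRing.*-commutativeMonoid ring) (x *_) (x⁻¹ *_)
                    (unscaleˡ x*x⁻¹) (unscaleˡ (trans (*-comm x⁻¹ x) x*x⁻¹)) unit

  fermat : ∀ x → x ^ q ≡ x
  fermat x with x ≟ 0#
  ... | no x≢0   = fermat-nonzero x x≢0
  ... | yes refl = zero-power (ℕₚ.m^n>0 2 m)
    where
    zero-power : ∀ {n} → 0 < n → 0# ^ n ≡ 0#
    zero-power {suc n} _ = zeroˡ (0# ^ n)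

  frob-power : ∀ i x → frob i x ≡ x ^ (2 ℕ.^ i)
  frob-power zero x = sym (*-identityʳ x)
  frob-power (suc i) x = begin
    frob i x * frob i x                    ≡⟨ cong₂ _*_ (frob-power i x) (frob-power i x) ⟩
    x ^ (2 ℕ.^ i) * x ^ (2 ℕ.^ i)          ≡⟨ sym (^-homo-* x (2 ℕ.^ i) (2 ℕ.^ i)) ⟩
    x ^ (2 ℕ.^ i ℕ.+ 2 ℕ.^ i)              ≡⟨ cong (λ n → x ^ (2 ℕ.^ i ℕ.+ n))
                                                   (sym (ℕₚ.+-identityʳ (2 ℕ.^ i))) ⟩
    x ^ (2 ℕ.^ suc i)                      ∎
    where open ≡-Reasoning

  frob-fixes : ∀ x → frob m x ≡ x
  frob-fixes x = trans (frob-power m x) (fermat x)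

  frob-+ : ∀ i a b → frob i (a + b) ≡ frob i a + frob i b
  frob-+ zero    a b = refl
  frob-+ (suc i) a b = trans (cong (λ z → z * z) (frob-+ i a b)) (square-+ (frob i a) (frob i b))

  power-2^i-+ : ∀ i a b → (a + b) ^ (2 ℕ.^ i) ≡ a ^ (2 ℕ.^ i) + b ^ (2 ℕ.^ i)
  power-2^i-+ i a b = trans (sym (frob-power i (a + b)))
                            (trans (frob-+ i a b) (cong₂ _+_ (frob-power i a) (frob-power i b)))

  frob-square : ∀ i x → frob i (x * x) ≡ frob (suc i) x
  frob-square zero    x = refl
  frob-square (suc i) x = cong (λ z → z * z) (frob-square i x)

  trSum-+ : ∀ n a b → trSum n (a + b) ≡ trSum n a + trSum n b
  trSum-+ zero    a b = sym (+-identityʳ 0#)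
  trSum-+ (suc n) a b =
    trans (cong₂ _+_ (trSum-+ n a b) (frob-+ n a b))
          (solve 4 (λ s t u v → (s :+ t) :+ (u :+ v) := (s :+ u) :+ (t :+ v)) refl
                 (trSum n a) (trSum n b) (frob n a) (frob n b))

  Tr-+ : ∀ a b → Tr (a + b) ≡ Tr a + Tr b
  Tr-+ = trSum-+ m

  Tr-0 : Tr 0# ≡ 0#
  Tr-0 = trans (cong Tr (sym (+-identityʳ 0#))) (trans (Tr-+ 0# 0#) (x+x≡0 (Tr 0#)))

  trSum-telescope : ∀ n y → trSum n (y * y) + y ≡ trSum n y + frob n y
  trSum-telescope zero    y = refl
  trSum-telescope (suc n) y = begin
    (trSum n (y * y) + frob n (y * y)) + y   ≡⟨ solve 3 (λ s f y → (s :+ f) :+ y := (s :+ y) :+ f) refl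
                                                   (trSum n (y * y)) (frob n (y * y)) y ⟩
    (trSum n (y * y) + y) + frob n (y * y)   ≡⟨ cong₂ _+_ (trSum-telescope n y) (frob-square n y) ⟩
    (trSum n y + frob n y) + frob (suc n) y  ∎
    where open ≡-Reasoning

  -- Tr(y²) = Tr(y), as y^(2^m) = y closes the telescope.
  Tr-square : ∀ y → Tr (y * y) ≡ Tr y
  Tr-square y = Additive.∙-cancelʳ y (Tr (y * y)) (Tr y)
                  (trans (trSum-telescope m y) (cong (Tr y +_) (frob-fixes y)))

  trSum-squared : ∀ n y → trSum n y * trSum n y ≡ trSum n (y * y)
  trSum-squared zero    y = zeroˡ 0#
  trSum-squared (suc n) y =
    trans (square-+ (trSum n y) (frob n y)) (cong₂ _+_ (trSum-squared n y) (sym (frob-square n y)))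

  -- Tr(y)² = Tr(y²) = Tr(y), so the trace takes only the values 0 and 1.
  Tr-boolean : ∀ y → Tr y ≡ 0# ⊎ Tr y ≡ 1#
  Tr-boolean y = idempotent (trans (trSum-squared m y) (Tr-square y))

  -- `Poly d c f`: f is a polynomial function of degree ≤ d whose coefficient
  -- of x^d is c, described without coefficients: at every point r,
  -- f(x) = f(r) + (x - r) g(x) with g of the same kind one degree lower
  -- (in characteristic 2, x - r = x + r).
  data Poly : ℕ → F → (F → F) → Set where
    constant : ∀ {c f} → (∀ x → f x ≡ c) → Poly zero c f
    factors  : ∀ {d c f} → (∀ r → ∃ λ g → Poly d c g × (∀ x → f x ≡ f r + (x + r) * g x)) →
               Poly (suc d) c f

  poly-cong : ∀ {d c f g} → (∀ x → f x ≡ g x) → Poly d c f → Poly d c g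
  poly-cong f≗g (constant f≡c) = constant λ x → trans (sym (f≗g x)) (f≡c x)
  poly-cong f≗g (factors split) = factors λ r →
    let (h , ph , split-r) = split r
    in h , ph , λ x → trans (sym (f≗g x)) (trans (split-r x) (cong (_+ _) (f≗g r)))

  poly-+ : ∀ {d c c′ f g} → Poly d c f → Poly d c′ g → Poly d (c + c′) (λ x → f x + g x)
  poly-+ (constant f≡c) (constant g≡c′) = constant λ x → cong₂ _+_ (f≡c x) (g≡c′ x)
  poly-+ {f = f} {g} (factors split-f) (factors split-g) = factors λ r →
    let (f′ , pf′ , split-fr) = split-f r
        (g′ , pg′ , split-gr) = split-g r
    in (λ x → f′ x + g′ x) , poly-+ pf′ pg′ , λ x →
       trans (cong₂ _+_ (split-fr x) (split-gr x))
             (solve 5 (λ a b y u v → (a :+ y :* u) :+ (b :+ y :* v) := (a :+ b) :+ y :* (u :+ v)) refl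
                    (f r) (g r) (x + r) (f′ x) (g′ x))

  poly-scale : ∀ {d c f} k → Poly d c f → Poly d (k * c) (λ x → k * f x)
  poly-scale k (constant f≡c) = constant λ x → cong (k *_) (f≡c x)
  poly-scale {f = f} k (factors split) = factors λ r →
    let (g , pg , split-r) = split r
    in (λ x → k * g x) , poly-scale k pg , λ x →
       trans (cong (k *_) (split-r x))
             (solve 4 (λ k a y u → k :* (a :+ y :* u) := k :* a :+ y :* (k :* u)) refl k (f r) (x + r) (g x))

  poly-raise : ∀ {d c f} → Poly d c f → Poly (suc d) 0# f
  poly-raise {f = f} (constant f≡c) = factors λ r → (λ _ → 0#) , constant (λ _ → refl) , λ x → begin
    f x                  ≡⟨ trans (f≡c x) (sym (f≡c r)) ⟩
    f r                  ≡⟨ sym (+-identityʳ (f r)) ⟩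
    f r + 0#             ≡⟨ cong (f r +_) (sym (zeroʳ (x + r))) ⟩
    f r + (x + r) * 0#   ∎
    where open ≡-Reasoning
  poly-raise (factors split) = factors λ r → let (g , pg , split-r) = split r in g , poly-raise pg , split-r

  poly-lift : ∀ {d e c f} → Poly d c f → d < e → Poly e 0# f
  poly-lift {d} {f = f} pf d<e = lift (ℕₚ.≤⇒≤′ d<e)
    where
    lift : ∀ {e} → suc d ≤′ e → Poly e 0# f
    lift ℕ.≤′-refl        = poly-raise pf
    lift (ℕ.≤′-step d<e) = poly-raise (lift d<e)

  -- The quotient (x^(k+1) - r^(k+1)) / (x - r) = Σ_{i ≤ k} x^i r^(k-i), via its recurrence.
  quotient : F → ℕ → F → F
  quotient r zero    x = 1#
  quotient r (suc k) x = x ^ suc k + r * quotient r k x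

  power-split : ∀ k r x → x ^ suc k ≡ r ^ suc k + (x + r) * quotient r k x
  power-split zero r x = begin
    x * 1#                              ≡⟨ sym (drop-double (x * 1#) (r * 1#)) ⟩
    x * 1# + (r * 1# + r * 1#)          ≡⟨ solve 3 (λ x r o → x :* o :+ (r :* o :+ r :* o) :=
                                              r :* o :+ (x :+ r) :* o) refl x r 1# ⟩
    r * 1# + (x + r) * 1#               ∎
    where open ≡-Reasoning
  power-split (suc k) r x = begin
    x * X                                ≡⟨ sym (drop-double (x * X) (r * R + r * X)) ⟩
    x * X + ((r * R + r * X) + (r * R + r * X))
                                         ≡⟨ solve 4 (λ x r X R →
                                              x :* X :+ ((r :* R :+ r :* X) :+ (r :* R :+ r :* X)) :=
                                              r :* R :+ (x :+ r) :* X :+ r :* (R :+ X)) refl x r X R ⟩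
    r * R + (x + r) * X + r * (R + X)    ≡⟨ cong (λ z → r * R + (x + r) * X + r * z)
                                              (sym (+-solve (sym (power-split k r x)))) ⟩
    r * R + (x + r) * X + r * ((x + r) * Q)
                                         ≡⟨ solve 5 (λ x r X R Q →
                                              r :* R :+ (x :+ r) :* X :+ r :* ((x :+ r) :* Q) :=
                                              r :* R :+ (x :+ r) :* (X :+ r :* Q)) refl x r X R Q ⟩
    r * R + (x + r) * (X + r * Q)        ∎
    where
    open ≡-Reasoning
    X R Q : F
    X = x ^ suc k
    R = r ^ suc k
    Q = quotient r k x

  power-poly : ∀ k → Poly k 1# (_^ k)
  quotient-poly : ∀ r k → Poly k 1# (quotient r k)
  power-poly zero    = constant λ _ → refl
  power-poly (suc k) = factors λ r → quotient r k , quotient-poly r k , power-split k r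
  quotient-poly r zero    = constant λ _ → refl
  quotient-poly r (suc k) = subst (λ c → Poly (suc k) c (quotient r (suc k))) (+-identityʳ 1#)
                              (poly-+ (power-poly (suc k)) (poly-raise (poly-scale r (quotient-poly r k))))

  frob-poly : ∀ i → Poly (2 ℕ.^ i) 1# (frob i)
  frob-poly i = poly-cong (sym ∘ frob-power i) (power-poly (2 ℕ.^ i))

  trSum-poly : ∀ j → Poly (2 ℕ.^ j) 0# (trSum j)
  trSum-poly zero    = poly-raise (constant {0#} λ _ → refl)
  trSum-poly (suc j) = subst (λ c → Poly (2 ℕ.^ suc j) c (trSum (suc j))) (+-identityʳ 0#)
                         (poly-+ (poly-lift (trSum-poly j) (2^n<2^1+n j)) (poly-lift (frob-poly j) (2^n<2^1+n j)))

  root-of-quotient : ∀ {f g : F → F} {r y : F} → (∀ x → f x ≡ f r + (x + r) * g x) →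
                     f r ≡ 0# → f y ≡ 0# → y ≢ r → g y ≡ 0#
  root-of-quotient {f} {g} {r} {y} split fr≡0 fy≡0 y≢r = zero-product (begin
    (y + r) * g y         ≡⟨ sym (+-identityˡ _) ⟩
    0# + (y + r) * g y    ≡⟨ cong (_+ (y + r) * g y) (sym fr≡0) ⟩
    f r + (y + r) * g y   ≡⟨ sym (split y) ⟩
    f y                   ≡⟨ fy≡0 ⟩
    0#                    ∎) (y≢r ∘ sum≡0⇒≡)
    where open ≡-Reasoning

  root-bound : ∀ {d c f} → Poly d c f → c ≢ 0# →
               (p : Fin (suc d) → F) → Injective _≡_ _≡_ p → ¬ (∀ i → f (p i) ≡ 0#)
  root-bound (constant f≡c) c≢0 p _ roots = c≢0 (trans (sym (f≡c (p Fin.zero))) (roots Fin.zero))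
  root-bound {f = f} (factors split) c≢0 p p-inj roots =
    let (g , pg , split-p₀) = split (p Fin.zero)
    in root-bound pg c≢0 (p ∘ Fin.suc) (Finₚ.suc-injective ∘ p-inj)
         (λ i → root-of-quotient {f} {g} split-p₀ (roots Fin.zero) (roots (Fin.suc i)) (suc≢zero ∘ p-inj))
    where
    suc≢zero : ∀ {n} {i : Fin n} → Fin.suc i ≢ Fin.zero
    suc≢zero ()

  not-identically-zero : ∀ {d c f} → Poly d c f → c ≢ 0# → d < q → ¬ (∀ x → f x ≡ 0#)
  not-identically-zero pf c≢0 d<q f≡0 =
    root-bound pf c≢0 (elem ∘ (λ i → inject≤ i d<q))
      (Finₚ.inject≤-injective d<q d<q _ _ ∘ elem-injective) (λ i → f≡0 _)

module TraceForms {m′ : ℕ} (K : GF2^ (suc m′)) where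
  open FiniteField K public
  open NatSolver (CommutativeRing.commutativeSemiring ring) (λ _ _ → nothing)
    using (solve; _:=_; _:+_; _:*_; _:^_; con)

  -- Tr = trSum (m-1) + x^(2^(m-1)) is monic of degree 2^(m-1) < q.
  Tr-poly : Poly (2 ℕ.^ m′) 1# Tr
  Tr-poly = subst (λ c → Poly (2 ℕ.^ m′) c Tr) (+-identityˡ 1#) (poly-+ (trSum-poly m′) (frob-poly m′))

  -- Hence the trace is not identically 0, and being {0,1}-valued it takes the value 1.
  Tr-onto : ∃ λ z → Tr z ≡ 1#
  Tr-onto with search (λ z → Tr z ≟ 1#)
  ... | yes found = found
  ... | no none   = ⊥-elim (not-identically-zero Tr-poly 1≢0 (2^n<2^1+n m′) Tr≡0)
    where
    Tr≡0 : ∀ z → Tr z ≡ 0#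
    Tr≡0 z = [ id , (λ Tr≡1 → ⊥-elim (none (z , Tr≡1))) ]′ (Tr-boolean z)

  Tr-linear : ∀ c a b → Tr (c * (a + b)) ≡ Tr (c * a) + Tr (c * b)
  Tr-linear c a b = trans (cong Tr (distribˡ c a b)) (Tr-+ (c * a) (c * b))

  Tr-nondegenerate : ∀ w → w ≢ 0# → ∃ λ b → Tr (w * b) ≡ 1#
  Tr-nondegenerate w w≢0 =
    let (w⁻¹ , ww⁻¹≡1) = inverse w w≢0
        (z , Tr-z≡1)   = Tr-onto
    in w⁻¹ * z , trans (cong Tr (unscaleˡ ww⁻¹≡1 z)) Tr-z≡1

  Tr-form-zero : ∀ {w} → (∀ b → Tr (b * w) ≡ 0#) → w ≡ 0#
  Tr-form-zero {w} ⊥w with w ≟ 0#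
  ... | yes w≡0 = w≡0
  ... | no w≢0  = let (b , Tr-wb≡1) = Tr-nondegenerate w w≢0
                  in ⊥-elim (0≢1 (trans (sym (⊥w b)) (trans (cong Tr (*-comm b w)) Tr-wb≡1)))

  annihilator : ∀ t w → (∀ b → Tr (t * b) ≡ 0# → Tr (w * b) ≡ 0#) → w ≡ 0# ⊎ w ≡ t
  annihilator t w ann with w ≟ 0# | w ≟ t
  ... | yes w≡0 | _       = inj₁ w≡0
  ... | no _    | yes w≡t = inj₂ w≡t
  ... | no w≢0  | no w≢t  =
    ⊥-elim (separate (Tr-nondegenerate w w≢0) (Tr-nondegenerate (t + w) (w≢t ∘ sym ∘ sum≡0⇒≡)))
    where
    -- Contrapositive of the hypothesis, as traces are 0 or 1.
    forces : ∀ b → Tr (w * b) ≡ 1# → Tr (t * b) ≡ 1#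
    forces b wb≡1 = [ (λ tb≡0 → ⊥-elim (0≢1 (trans (sym (ann b tb≡0)) wb≡1))) , id ]′ (Tr-boolean (t * b))

    separate : (∃ λ b → Tr (w * b) ≡ 1#) → (∃ λ b → Tr ((t + w) * b) ≡ 1#) → ⊥
    separate (b₁ , wb₁≡1) (b₂ , twb₂≡1) = [ b₂-outside , b₂-inside ]′ (Tr-boolean (w * b₂))
      where
      split₂ : Tr (t * b₂) + Tr (w * b₂) ≡ 1#
      split₂ = trans (sym (Tr-+ (t * b₂) (w * b₂))) (trans (cong Tr (sym (distribʳ b₂ t w))) twb₂≡1)
      -- Tr(w b₂) = 1 would force Tr(t b₂) = 1, but the two sum to 1.
      b₂-inside : Tr (w * b₂) ≡ 1# → ⊥
      b₂-inside wb₂≡1 =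
        0≢1 (trans (sym 1+1≡0) (trans (cong₂ _+_ (sym (forces b₂ wb₂≡1)) (sym wb₂≡1)) split₂))
      -- Tr(w b₂) = 0 makes Tr(t b₂) = 1, so b₁ + b₂ violates the hypothesis.
      b₂-outside : Tr (w * b₂) ≡ 0# → ⊥
      b₂-outside wb₂≡0 = 0≢1 (begin
        0#                         ≡⟨ sym 1+1≡0 ⟩
        1# + 1#                    ≡⟨ cong₂ _+_ (sym (forces b₁ wb₁≡1)) (sym tb₂≡1) ⟩
        Tr (t * b₁) + Tr (t * b₂)  ≡⟨ sym (Tr-linear t b₁ b₂) ⟩
        Tr (t * (b₁ + b₂))         ≡⟨ forces (b₁ + b₂) w-b₁+b₂≡1 ⟩
        1#                         ∎)
        where
        open ≡-Reasoning
        tb₂≡1 : Tr (t * b₂) ≡ 1#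
        tb₂≡1 = trans (sym (+-identityʳ _)) (trans (cong (Tr (t * b₂) +_) (sym wb₂≡0)) split₂)
        w-b₁+b₂≡1 : Tr (w * (b₁ + b₂)) ≡ 1#
        w-b₁+b₂≡1 = trans (Tr-linear w b₁ b₂) (trans (cong₂ _+_ wb₁≡1 wb₂≡0) (+-identityʳ 1#))

  Q : F → F
  Q x = Tr (cube x)

  Q-0 : Q 0# ≡ 0#
  Q-0 = trans (cong Tr (zeroʳ (0# * 0#))) Tr-0

  Q-square : ∀ a → Q (a * a) ≡ Q a
  Q-square a = trans (cong Tr (solve 1 (λ a → a :* a :* (a :* a) :* (a :* a) :=
                                              (a :* a :* a) :* (a :* a :* a)) refl a))
                     (Tr-square (cube a))

  -- L(a) = a² + a^(2^(m-1)) represents the polar form of Q (see Q-polar).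
  L : F → F
  L a = a * a + frob m′ a

  L-+ : ∀ a b → L (a + b) ≡ L a + L b
  L-+ a b = trans (cong₂ _+_ (square-+ a b) (frob-+ m′ a b))
                  (solve 4 (λ u v f g → (u :+ v) :+ (f :+ g) := (u :+ f) :+ (v :+ g)) refl
                         (a * a) (b * b) (frob m′ a) (frob m′ b))

  L-square : ∀ a → L (a * a) ≡ L a * L a
  L-square a = trans (cong (a * a * (a * a) +_) (frob-square m′ a)) (sym (square-+ (a * a) (frob m′ a)))

  -- L(a)² = a⁴ + a, since (a^(2^(m-1)))² = a^(2^m) = a.
  L-squared : ∀ a → L a * L a ≡ a ^ 4 + a
  L-squared a = trans (square-+ (a * a) (frob m′ a))
                      (cong₂ _+_ (solve 1 (λ a → a :* a :* (a :* a) := a :^ 4) refl a) (frob-fixes a))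

  cube-+ : ∀ x a → cube (x + a) ≡ cube x + cube a + (x * x * a + x * a * a)
  cube-+ x a = begin
    (x + a) * (x + a) * (x + a)                  ≡⟨ solve 2 (λ x a → (x :+ a) :* (x :+ a) :* (x :+ a) :=
                                                      x :* x :* x :+ a :* a :* a :+ (x :* x :* a :+ x :* a :* a) :+
                                                      (x :* x :* a :+ x :* a :* a :+ (x :* x :* a :+ x :* a :* a))) refl x a ⟩
    cube x + cube a + c + (c + c)                ≡⟨ drop-double (cube x + cube a + c) c ⟩
    cube x + cube a + c                          ∎
    where
    open ≡-Reasoning
    c : F
    c = x * x * a + x * a * a

  -- Tr(x² a + x a²) = Tr(x L(a)): write a = h² with h = a^(2^(m-1)), then Tr(x² h²) = Tr(x h).
  cross-term : ∀ x a → Tr (x * x * a + x * a * a) ≡ Tr (x * L a)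
  cross-term x a = begin
    Tr (x * x * a + x * a * a)             ≡⟨ cong (λ z → Tr (x * x * z + x * a * a)) (sym (frob-fixes a)) ⟩
    Tr (x * x * (h * h) + x * a * a)       ≡⟨ Tr-+ (x * x * (h * h)) (x * a * a) ⟩
    Tr (x * x * (h * h)) + Tr (x * a * a)  ≡⟨ cong (_+ Tr (x * a * a)) (trans (cong Tr (solve 2 (λ x h →
                                                x :* x :* (h :* h) := (x :* h) :* (x :* h)) refl x h)) (Tr-square (x * h))) ⟩
    Tr (x * h) + Tr (x * a * a)            ≡⟨ sym (Tr-+ (x * h) (x * a * a)) ⟩
    Tr (x * h + x * a * a)                 ≡⟨ cong Tr (solve 3 (λ x h a → x :* h :+ x :* a :* a :=
                                                x :* (a :* a :+ h)) refl x h a) ⟩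
    Tr (x * L a)                           ∎
    where
    open ≡-Reasoning
    h : F
    h = frob m′ a

  Q-polar : ∀ x a → Q (x + a) ≡ Q x + Q a + Tr (x * L a)
  Q-polar x a = trans (cong Tr (cube-+ x a))
                      (trans (Tr-+ (cube x + cube a) _) (cong₂ _+_ (Tr-+ (cube x) (cube a)) (cross-term x a)))

  -- For m ≥ 3, Q is not identically zero: otherwise its polar form vanishes, so L = 0
  -- and every x is a root of the quartic x⁴ + x, while q ≥ 8.
  Q-not-identically-zero : 3 ≤ suc m′ → ¬ (∀ a → Q a ≡ 0#)
  Q-not-identically-zero m≥3 Q≡0 = not-identically-zero quartic-poly 1≢0 4<q quartic-vanishes
    where
    polar≡0 : ∀ x a → Tr (x * L a) ≡ 0#
    polar≡0 x a = sym (begin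
      0#                          ≡⟨ sym (Q≡0 (x + a)) ⟩
      Q (x + a)                   ≡⟨ Q-polar x a ⟩
      Q x + Q a + Tr (x * L a)    ≡⟨ cong₂ (λ u v → u + v + Tr (x * L a)) (Q≡0 x) (Q≡0 a) ⟩
      0# + 0# + Tr (x * L a)      ≡⟨ trans (cong (_+ Tr (x * L a)) (+-identityʳ 0#)) (+-identityˡ _) ⟩
      Tr (x * L a)                ∎)
      where open ≡-Reasoning
    quartic-vanishes : ∀ a → a ^ 4 + a ≡ 0#
    quartic-vanishes a = trans (sym (L-squared a)) (trans (cong (λ z → z * z) (Tr-form-zero (λ x → polar≡0 x a)))
                                                          (zeroˡ 0#))
    quartic-poly : Poly 4 1# (λ x → x ^ 4 + x)
    quartic-poly = subst (λ c → Poly 4 c (λ x → x ^ 4 + x)) (+-identityʳ 1#)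
                     (poly-+ (power-poly 4) (poly-lift (poly-cong *-identityʳ (power-poly 1)) (s≤s (s≤s z≤n))))
    4<q : 4 < q
    4<q = ℕₚ.≤-trans (s≤s (s≤s (s≤s (s≤s (s≤s z≤n))))) (ℕₚ.^-monoʳ-≤ 2 m≥3)

  -- The level set {Q = 1} never lies inside the roots of x⁴ + x + 1: for such an a,
  -- ω = a⁵ is a cube root of unity, ωa is again in the level set, and comparing
  -- (ωa)⁴ + ωa = 1 with a⁴ + a = 1 gives ω = 1, which is incompatible with a⁴ = a + 1.
  quartic-obstruction : (∀ b → Q b ≡ 1# → b ^ 4 + b ≡ 1#) → ∀ a → Q a ≢ 1#
  quartic-obstruction quartic a Qa≡1 = 1≢0 (Additive.∙-cancelˡ a 1# 0# (begin
    a + 1#          ≡⟨ sym a⁴ ⟩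
    a ^ 4           ≡⟨ solve 1 (λ a → a :^ 4 := (a :^ 2) :^ 2) refl a ⟩
    (a ^ 2) ^ 2     ≡⟨ cong (_^ 2) a² ⟩
    (a + 1#) ^ 2    ≡⟨ [a+1]²≡a ⟩
    a               ≡⟨ sym (+-identityʳ a) ⟩
    a + 0#          ∎))
    where
    open ≡-Reasoning
    ω : F
    ω = a ^ 5

    1^ : ∀ n → 1# ^ n ≡ 1#
    1^ zero    = refl
    1^ (suc n) = trans (*-identityˡ (1# ^ n)) (1^ n)

    +1+1 : ∀ u → (u + 1#) + 1# ≡ u
    +1+1 u = trans (+-assoc u 1# 1#) (drop-double u 1#)

    a⁴ : a ^ 4 ≡ a + 1#
    a⁴ = +-solve (trans (+-comm a (a ^ 4)) (quartic a Qa≡1))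

    a≢0 : a ≢ 0#
    a≢0 a≡0 = 0≢1 (trans (sym Q-0) (subst (λ z → Q z ≡ 1#) a≡0 Qa≡1))

    a¹⁶ : a ^ 16 ≡ a
    a¹⁶ = begin
      a ^ 16              ≡⟨ solve 1 (λ a → a :^ 16 := (a :^ 4) :^ 4) refl a ⟩
      (a ^ 4) ^ 4         ≡⟨ cong (_^ 4) a⁴ ⟩
      (a + 1#) ^ 4        ≡⟨ power-2^i-+ 2 a 1# ⟩
      a ^ 4 + 1# ^ 4      ≡⟨ cong₂ _+_ a⁴ (1^ 4) ⟩
      (a + 1#) + 1#       ≡⟨ +1+1 a ⟩
      a                   ∎

    ω³ : ω ^ 3 ≡ 1#
    ω³ = *-cancelʳ a≢0 (begin
      ω ^ 3 * a           ≡⟨ solve 1 (λ a → (a :^ 5) :^ 3 :* a := a :^ 16) refl a ⟩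
      a ^ 16              ≡⟨ a¹⁶ ⟩
      a                   ≡⟨ sym (*-identityˡ a) ⟩
      1# * a              ∎)

    Q-ωa : Q (ω * a) ≡ 1#
    Q-ωa = trans (cong Tr (begin
      cube (ω * a)        ≡⟨ solve 2 (λ w a → (w :* a) :* (w :* a) :* (w :* a) := w :^ 3 :* (a :* a :* a)) refl ω a ⟩
      ω ^ 3 * cube a      ≡⟨ trans (cong (_* cube a) ω³) (*-identityˡ (cube a)) ⟩
      cube a              ∎)) Qa≡1

    ω≡1 : ω ≡ 1#
    ω≡1 = sym (begin
      1#                              ≡⟨ sym (quartic (ω * a) Q-ωa) ⟩
      (ω * a) ^ 4 + ω * a             ≡⟨ solve 2 (λ w a → (w :* a) :^ 4 :+ w :* a :=
                                           w :^ 3 :* (w :* (a :^ 4)) :+ w :* a) refl ω a ⟩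
      ω ^ 3 * (ω * a ^ 4) + ω * a     ≡⟨ cong (λ z → z * (ω * a ^ 4) + ω * a) ω³ ⟩
      1# * (ω * a ^ 4) + ω * a        ≡⟨ cong (_+ ω * a) (*-identityˡ (ω * a ^ 4)) ⟩
      ω * a ^ 4 + ω * a               ≡⟨ sym (distribˡ ω (a ^ 4) a) ⟩
      ω * (a ^ 4 + a)                 ≡⟨ cong (ω *_) (quartic a Qa≡1) ⟩
      ω * 1#                          ≡⟨ *-identityʳ ω ⟩
      ω                               ∎)

    a² : a ^ 2 ≡ a + 1#
    a² = +-solve (begin
      a + a ^ 2           ≡⟨ solve 1 (λ a → a :+ a :^ 2 := a :* (a :+ con 1)) refl a ⟩
      a * (a + 1#)        ≡⟨ cong (a *_) (sym a⁴) ⟩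
      a * a ^ 4           ≡⟨ ω≡1 ⟩
      1#                  ∎)

    [a+1]²≡a : (a + 1#) ^ 2 ≡ a
    [a+1]²≡a = begin
      (a + 1#) ^ 2        ≡⟨ power-2^i-+ 1 a 1# ⟩
      a ^ 2 + 1# ^ 2      ≡⟨ cong₂ _+_ a² (1^ 2) ⟩
      (a + 1#) + 1#       ≡⟨ +1+1 a ⟩
      a                   ∎

  -- The situation excluded by the corollary: t ≠ 0 and Q vanishes on the affine
  -- hyperplane Tr(t x) = 1, which contains some x₀ by nondegeneracy.
  module Vanishing (t : F) (t≢0 : t ≢ 0#) (vanish : ∀ x → Tr (t * x) ≡ 1# → Q x ≡ 0#) where

    x₀ : F
    x₀ = proj₁ (Tr-nondegenerate t t≢0)

    tx₀≡1 : Tr (t * x₀) ≡ 1#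
    tx₀≡1 = proj₂ (Tr-nondegenerate t t≢0)

    shift-by-H : ∀ {x a c} → Tr (t * x) ≡ c → Tr (t * a) ≡ 0# → Tr (t * (x + a)) ≡ c
    shift-by-H {x} {a} {c} tx≡c ta≡0 = trans (Tr-linear t x a) (trans (cong₂ _+_ tx≡c ta≡0) (+-identityʳ c))

    -- On the hyperplane H : Tr(t a) = 0}, Q is the linear form a ↦ Tr(x₀ L(a)),
    -- since x₀ + a lies in the affine hyperplane where Q vanishes.
    Q-on-H : ∀ a → Tr (t * a) ≡ 0# → Q a ≡ Tr (x₀ * L a)
    Q-on-H a ta≡0 = sum≡0⇒≡ (sym (begin
      0#                             ≡⟨ sym (vanish (x₀ + a) (shift-by-H tx₀≡1 ta≡0)) ⟩
      Q (x₀ + a)                     ≡⟨ Q-polar x₀ a ⟩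
      Q x₀ + Q a + Tr (x₀ * L a)     ≡⟨ cong (λ z → z + Q a + Tr (x₀ * L a)) (vanish x₀ tx₀≡1) ⟩
      0# + Q a + Tr (x₀ * L a)       ≡⟨ cong (_+ Tr (x₀ * L a)) (+-identityˡ (Q a)) ⟩
      Q a + Tr (x₀ * L a)            ∎))
      where open ≡-Reasoning

    polar-on-H : ∀ a b → Tr (t * a) ≡ 0# → Tr (t * b) ≡ 0# → Tr (b * L a) ≡ 0#
    polar-on-H a b ta≡0 tb≡0 = Additive.∙-cancelˡ (Q b + Q a) _ 0# (begin
      Q b + Q a + Tr (b * L a)           ≡⟨ sym (Q-polar b a) ⟩
      Q (b + a)                          ≡⟨ Q-on-H (b + a) (shift-by-H tb≡0 ta≡0) ⟩
      Tr (x₀ * L (b + a))                ≡⟨ cong (λ z → Tr (x₀ * z)) (L-+ b a) ⟩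
      Tr (x₀ * (L b + L a))              ≡⟨ Tr-linear x₀ (L b) (L a) ⟩
      Tr (x₀ * L b) + Tr (x₀ * L a)      ≡⟨ sym (cong₂ _+_ (Q-on-H b tb≡0) (Q-on-H a ta≡0)) ⟩
      Q b + Q a                          ≡⟨ sym (+-identityʳ (Q b + Q a)) ⟩
      Q b + Q a + 0#                     ∎)
      where open ≡-Reasoning

    L-on-H : ∀ a → Tr (t * a) ≡ 0# → L a ≡ 0# ⊎ L a ≡ t
    L-on-H a ta≡0 = annihilator t (L a) λ b tb≡0 → trans (cong Tr (*-comm (L a) b)) (polar-on-H a b ta≡0 tb≡0)

    -- An a with Q(a) = 1 lies in H (Q vanishes off H) and has L(a) ≠ 0 (as Q = Tr(x₀ L(·)) on H).
    L-level-1 : ∀ a → Q a ≡ 1# → L a ≡ t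
    L-level-1 a Qa≡1 =
      [ in-H , (λ ta≡1 → ⊥-elim (0≢1 (trans (sym (vanish a ta≡1)) Qa≡1))) ]′ (Tr-boolean (t * a))
      where
      in-H : Tr (t * a) ≡ 0# → L a ≡ t
      in-H ta≡0 = [ (λ La≡0 → ⊥-elim (0≢1 (begin
          0#                 ≡⟨ sym Tr-0 ⟩
          Tr 0#              ≡⟨ cong Tr (sym (trans (cong (x₀ *_) La≡0) (zeroʳ x₀))) ⟩
          Tr (x₀ * L a)      ≡⟨ sym (Q-on-H a ta≡0) ⟩
          Q a                ≡⟨ Qa≡1 ⟩
          1#                 ∎))) , id ]′ (L-on-H a ta≡0)
        where open ≡-Reasoning

    -- Applying this to a and a² (Q(a²) = Q(a)) gives t = L(a²) = L(a)² = t², so t = 1.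
    t≡1 : ∀ a → Q a ≡ 1# → t ≡ 1#
    t≡1 a Qa≡1 = [ (λ t≡0 → ⊥-elim (t≢0 t≡0)) , id ]′ (idempotent (begin
      t * t              ≡⟨ sym (cong₂ _*_ (L-level-1 a Qa≡1) (L-level-1 a Qa≡1)) ⟩
      L a * L a          ≡⟨ sym (L-square a) ⟩
      L (a * a)          ≡⟨ L-level-1 (a * a) (trans (Q-square a) Qa≡1) ⟩
      t                  ∎))
      where open ≡-Reasoning

    -- Then every a with Q(a) = 1 is a root of x⁴ + x + 1, which is impossible;
    -- so Q vanishes identically, which is impossible for m ≥ 3.
    absurd : 3 ≤ suc m′ → ⊥
    absurd m≥3 = Q-not-identically-zero m≥3 λ a →
      [ id , (λ Qa≡1 → ⊥-elim (Q≢1 a Qa≡1)) ]′ (Tr-boolean (cube a))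
      where
      Q≢1 : ∀ a → Q a ≢ 1#
      Q≢1 a Qa≡1 = quartic-obstruction (λ b Qb≡1 → begin
        b ^ 4 + b          ≡⟨ sym (L-squared b) ⟩
        L b * L b          ≡⟨ cong (λ z → z * z) (trans (L-level-1 b Qb≡1) (t≡1 a Qa≡1)) ⟩
        1# * 1#            ≡⟨ *-identityʳ 1# ⟩
        1#                 ∎) a Qa≡1
        where open ≡-Reasoning

corollary15 : (m : ℕ) → 3 ≤ m → (K : GF2^ m) →
    let open GF2^ K in
    ∀ (t : F) → t ≢ 0# →
      ∃ λ (x₁ : F) → (Tr (cube x₁) ≡ 1#) × (Tr (t * x₁) ≡ 1#)
corollary15 zero () K
corollary15 (suc m′) m≥3 K t t≢0 = decide (search λ x → (Q x ≟ 1#) ×-dec (Tr (t * x) ≟ 1#))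
  where
  open TraceForms K
  decide : Dec (∃ λ x₁ → (Q x₁ ≡ 1#) × (Tr (t * x₁) ≡ 1#)) →
           ∃ λ x₁ → (Q x₁ ≡ 1#) × (Tr (t * x₁) ≡ 1#)
  decide (yes witness) = witness
  decide (no none)     = ⊥-elim (Vanishing.absurd t t≢0 vanish m≥3)
    where
    vanish : ∀ x → Tr (t * x) ≡ 1# → Q x ≡ 0#
    vanish x tx≡1 = [ id , (λ Qx≡1 → ⊥-elim (none (x , Qx≡1 , tx≡1))) ]′ (Tr-boolean (cube x))
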